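{- Fix $t\in\{2,3\}$. If $G$ is a curious graph of type $t$ with respect to a partition $(V_1,V_2,V_3)$, then (after suitably renaming the three parts) $G$ can be partitioned into slices each of which is a curious graph of type at most $t-1$ with respect to the induced partition.
   Context: A graph $G$ is curious with respect to a partition $(V_1,V_2,V_3)$ of its vertex set into three (possibly empty) independent sets if there are no $x\in V_1,y\in V_2,z\in V_3$ with $G[\{x,y,z\}]$ a triangle or edgeless. It is of type $t$ if exactly $t$ of $G[V_1\cup V_2]$, $G[V_1\cup V_3]$, $G[V_2\cup V_3]$ contain an induced $2P_2$ (two disjoint edges). $G$ can be partitioned into slices if each $V_i$ can be partitioned into $V_i^0,\dots,V_i^\ell$ such that, with subscripts of the $V_i$ modulo $3$, for each $i$ and all $j<k$, $V_i^j$ is complete to $V_{i+1}^k$ and anti-complete to $V_{i+2}^k$; the slices are $G^j=G[V_1^j\cup V_2^j\cup V_3^j]$, considered with the partition $(V_1^j,V_2^j,V_3^j)$. -}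

module Defs where

open import Data.Nat using (ℕ; zero; suc; _+_; _<_; _≤_; _∸_)
open import Data.Fin using (Fin; zero; suc)
open import Data.Bool using (Bool; true; false; T)
open import Data.Product using (Σ; ∃; ∃-syntax; _×_; _,_)
open import Data.Sum using (_⊎_)
open import Relation.Nullary using (¬_)
open import Relation.Binary using (Decidable)
open import Relation.Binary.PropositionalEquality using (_≡_; _≢_)
open import Data.Fin.Permutation using (Permutation′; _⟨$⟩ʳ_)

record Graph (n : ℕ) : Set₁ where
  field
    E      : Fin n → Fin n → Set
    E-dec  : Decidable E
    E-sym  : ∀ {x y} → E x y → E y x
    E-irr  : ∀ {x} → ¬ E x x
open Graph public

-- A partition of the vertex set into three labelled (possibly empty) parts
-- V_1, V_2, V_3 is given by a labelling Fin n → Fin 3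
-- (label zero = V_1, label 1 = V_2, label 2 = V_3).
Part3 : ℕ → Set
Part3 n = Fin n → Fin 3

VSet : ℕ → Set₁
VSet n = Fin n → Set

module _ {n : ℕ} (G : Graph n) (p : Part3 n) (W : VSet n) where

  PartsIndependent : Set
  PartsIndependent = ∀ x y → W x → W y → p x ≡ p y → ¬ E G x y

  Curious : Set
  Curious = PartsIndependent ×
    (∀ x y z → W x → W y → W z →
       p x ≡ zero → p y ≡ suc zero → p z ≡ suc (suc zero) →
       ¬ ((E G x y × E G y z × E G x z) ⊎ (¬ E G x y × ¬ E G y z × ¬ E G x z)))

  Has2P2Avoiding : Fin 3 → Set
  Has2P2Avoiding k = Σ (Fin n) λ x₁ → Σ (Fin n) λ y₁ → Σ (Fin n) λ x₂ → Σ (Fin n) λ y₂ →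
    (W x₁ × W y₁ × W x₂ × W y₂) ×
    (p x₁ ≢ k × p y₁ ≢ k × p x₂ ≢ k × p y₂ ≢ k) ×
    (E G x₁ y₁ × E G x₂ y₂) ×
    (¬ E G x₁ x₂ × ¬ E G x₁ y₂ × ¬ E G y₁ x₂ × ¬ E G y₁ y₂)

count3 : (Fin 3 → Bool) → ℕ
count3 b = toℕ (b zero) + (toℕ (b (suc zero)) + toℕ (b (suc (suc zero))))
  where
    toℕ : Bool → ℕ
    toℕ true = 1
    toℕ false = 0

module _ {n : ℕ} (G : Graph n) (p : Part3 n) (W : VSet n) where

  -- The number of the three graphs G[V_i ∪ V_j] (restricted to W) containing an
  -- induced 2P2 is recorded by a characteristic vector b with b k = true iff
  -- the graph on the two parts other than k contains an induced 2P2.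
  Records2P2 : (Fin 3 → Bool) → Set
  Records2P2 b = ∀ k → (T (b k) → Has2P2Avoiding G p W k) × (Has2P2Avoiding G p W k → T (b k))

  OfType : ℕ → Set
  OfType t = ∃[ b ] (Records2P2 b × count3 b ≡ t)

  OfTypeAtMost : ℕ → Set
  OfTypeAtMost t = ∃[ b ] (Records2P2 b × count3 b ≤ t)

All : {n : ℕ} → VSet n
All _ = ⊤' where
  open import Data.Unit using () renaming (⊤ to ⊤')

next3 : Fin 3 → Fin 3
next3 zero = suc zero
next3 (suc zero) = suc (suc zero)
next3 (suc (suc zero)) = zero

-- Slice decomposition: sl x = j means x ∈ V_{p x}^j.  For all j < k,
-- V_i^j is complete to V_{i+1}^k and anticomplete to V_{i+2}^k.
-- (Indices range over ℕ; only finitely many are used since the graph is finite,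
-- so this is a partition into V_i^0, …, V_i^ℓ with ℓ the maximal index used.)
IsSliceDecomposition : {n : ℕ} → Graph n → Part3 n → (Fin n → ℕ) → Set
IsSliceDecomposition G p sl = ∀ x y → sl x < sl y →
  (p y ≡ next3 (p x) → E G x y) × (p y ≡ next3 (next3 (p x)) → ¬ E G x y)

Slice : {n : ℕ} → (Fin n → ℕ) → ℕ → VSet n
Slice sl j x = sl x ≡ j

rename : {n : ℕ} → Permutation′ 3 → Part3 n → Part3 n
rename σ p x = σ ⟨$⟩ʳ p x

-- Orient each pair of vertices in different parts: along an edge from V_i to V_{i+1}, along
-- a non-edge from V_{i+1} to V_i. This gives a 3-partite tournament, and curiosity says
-- exactly that it has no directed triangle, so it is transitive on triples from three
-- distinct parts. Ranking vertices by their number of ancestors orders the strong components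
-- topologically, which yields a slice decomposition. An induced 2P2 between two parts is a
-- directed 4-cycle; a vertex of the third part either beats the whole cycle or loses to all
-- of it, and following paths out of the cycle shows it cannot share its strong component.
-- Hence in each slice at most one pair of parts contains an induced 2P2: every slice has
-- type at most 1, whatever the type of G.

module Submission where

open import Defs
open import Data.Nat using (ℕ; _∸_)
open import Data.Sum using (_⊎_)
open import Data.Product using (∃-syntax; _×_)
open import Relation.Binary.PropositionalEquality using (_≡_)
open import Data.Fin.Permutation using (Permutation′)

open import Level using (Level; _⊔_)
open import Function using (_∘_; flip; id; Equivalence)
open import Data.Nat using (suc; _≤_; _<_; z≤n; s≤s) renaming (_≟_ to _≟ℕ_)
open import Data.Nat.Properties using (≤-trans; <⇒≱; <-irrefl)
open import Data.Fin using (Fin; zero; suc; punchOut) renaming (_≟_ to _≟F_)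
open import Data.Fin.Properties using (any?; punchOut-injective)
open import Data.Fin.Subset using (Subset; _∈_; _⊆_; ∣_∣)
open import Data.Fin.Subset.Properties using (p⊆q⇒∣p∣≤∣q∣; p⊂q⇒∣p∣<∣q∣)
open import Data.Vec using (tabulate)
open import Data.Vec.Properties using (lookup∘tabulate; lookup⇒[]=; []=⇒lookup)
open import Data.Bool.Properties using (T-≡)
open import Data.Sum using (inj₁; inj₂; [_,_]′)
open import Data.Product using (∃; _,_; proj₁; proj₂)
open import Data.Empty using (⊥)
open import Data.Unit using (tt)
open import Relation.Nullary using (Dec; yes; no; ¬_; contradiction)
open import Relation.Nullary.Decidable using (_×-dec_; _⊎-dec_; ¬?; isYes; map′; toWitness; fromWitness)
open import Relation.Unary using (Pred) renaming (Decidable to Decidable₁)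
open import Relation.Binary using (Rel; Decidable)
open import Relation.Binary.PropositionalEquality using (_≢_; refl; sym; trans; cong; ≢-sym)
open import Relation.Binary.Construct.Closure.ReflexiveTransitive using (Star; ε; _◅_; _◅◅_; reverse)
import Data.Fin.Permutation as Perm

private
  variable
    ℓ : Level

next3-cube : ∀ a → next3 (next3 (next3 a)) ≡ a
next3-cube zero             = refl
next3-cube (suc zero)       = refl
next3-cube (suc (suc zero)) = refl

next3-injective : ∀ {a b} → next3 a ≡ next3 b → a ≡ b
next3-injective {a} {b} e = trans (sym (next3-cube a)) (trans (cong (next3 ∘ next3) e) (next3-cube b))

next3-irrefl : ∀ a → next3 a ≢ a
next3-irrefl zero ()
next3-irrefl (suc zero) ()
next3-irrefl (suc (suc zero)) ()

next3²-irrefl : ∀ a → next3 (next3 a) ≢ a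
next3²-irrefl a e = next3-irrefl a (trans (sym (cong next3 e)) (next3-cube a))

≢⇒adjacent : ∀ {a b} → a ≢ b → b ≡ next3 a ⊎ a ≡ next3 b
≢⇒adjacent {zero}             {zero}             a≢b = contradiction refl a≢b
≢⇒adjacent {zero}             {suc zero}         _   = inj₁ refl
≢⇒adjacent {zero}             {suc (suc zero)}   _   = inj₂ refl
≢⇒adjacent {suc zero}         {zero}             _   = inj₂ refl
≢⇒adjacent {suc zero}         {suc zero}         a≢b = contradiction refl a≢b
≢⇒adjacent {suc zero}         {suc (suc zero)}   _   = inj₁ refl
≢⇒adjacent {suc (suc zero)}   {zero}             _   = inj₁ refl
≢⇒adjacent {suc (suc zero)}   {suc zero}         _   = inj₂ refl
≢⇒adjacent {suc (suc zero)}   {suc (suc zero)}   a≢b = contradiction refl a≢b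

fin2-collide : ∀ (i j l : Fin 2) → i ≡ j ⊎ i ≡ l ⊎ j ≡ l
fin2-collide zero       zero       _          = inj₁ refl
fin2-collide (suc zero) (suc zero) _          = inj₁ refl
fin2-collide zero       (suc zero) zero       = inj₂ (inj₁ refl)
fin2-collide zero       (suc zero) (suc zero) = inj₂ (inj₂ refl)
fin2-collide (suc zero) zero       zero       = inj₂ (inj₂ refl)
fin2-collide (suc zero) zero       (suc zero) = inj₂ (inj₁ refl)

avoiding-collide : ∀ {k a b c : Fin 3} → a ≢ k → b ≢ k → c ≢ k → a ≡ b ⊎ a ≡ c ⊎ b ≡ c
avoiding-collide a≢k b≢k c≢k
  with fin2-collide (punchOut (≢-sym a≢k)) (punchOut (≢-sym b≢k)) (punchOut (≢-sym c≢k))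
... | inj₁ e        = inj₁ (punchOut-injective (≢-sym a≢k) (≢-sym b≢k) e)
... | inj₂ (inj₁ e) = inj₂ (inj₁ (punchOut-injective (≢-sym a≢k) (≢-sym c≢k) e))
... | inj₂ (inj₂ e) = inj₂ (inj₂ (punchOut-injective (≢-sym b≢k) (≢-sym c≢k) e))

avoiding-pairs-match : ∀ {k a b c d : Fin 3} → a ≢ k → b ≢ k → c ≢ k → d ≢ k → a ≢ b → c ≢ d →
  (c ≡ a × d ≡ b) ⊎ (d ≡ a × c ≡ b)
avoiding-pairs-match a≢k b≢k c≢k d≢k a≢b c≢d
  with avoiding-collide a≢k b≢k c≢k | avoiding-collide a≢k b≢k d≢k
... | inj₁ a≡b        | _               = contradiction a≡b a≢b
... | _               | inj₁ a≡b        = contradiction a≡b a≢b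
... | inj₂ (inj₁ a≡c) | inj₂ (inj₁ a≡d) = contradiction (trans (sym a≡c) a≡d) c≢d
... | inj₂ (inj₁ a≡c) | inj₂ (inj₂ b≡d) = inj₁ (sym a≡c , sym b≡d)
... | inj₂ (inj₂ b≡c) | inj₂ (inj₁ a≡d) = inj₂ (sym a≡d , sym b≡c)
... | inj₂ (inj₂ b≡c) | inj₂ (inj₂ b≡d) = contradiction (trans (sym b≡c) b≡d) c≢d

count3-exclusive : {P : Pred (Fin 3) ℓ} (P? : Decidable₁ P) → (∀ {k k′} → k ≢ k′ → P k → ¬ P k′) →
  count3 (isYes ∘ P?) ≤ 1
count3-exclusive P? excl with P? zero | P? (suc zero) | P? (suc (suc zero))
... | yes a | yes b | _     = contradiction b (excl (λ ()) a)
... | yes a | no _  | yes c = contradiction c (excl (λ ()) a)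
... | no _  | yes b | yes c = contradiction c (excl (λ ()) b)
... | yes _ | no _  | no _  = s≤s z≤n
... | no _  | yes _ | no _  = s≤s z≤n
... | no _  | no _  | yes _ = s≤s z≤n
... | no _  | no _  | no _  = z≤n

toSubset : ∀ {n} {P : Pred (Fin n) ℓ} → Decidable₁ P → Subset n
toSubset P? = tabulate (isYes ∘ P?)

module _ {n} {P : Pred (Fin n) ℓ} {P? : Decidable₁ P} {x : Fin n} where

  ∈-toSubset⁺ : P x → x ∈ toSubset P?
  ∈-toSubset⁺ px = lookup⇒[]= x _
    (trans (lookup∘tabulate (isYes ∘ P?) x) (Equivalence.to T-≡ (fromWitness px)))

  ∈-toSubset⁻ : x ∈ toSubset P? → P x
  ∈-toSubset⁻ x∈ = toWitness (Equivalence.from T-≡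
    (trans (sym (lookup∘tabulate (isYes ∘ P?) x)) ([]=⇒lookup x∈)))

module _ {n} (R : Rel (Fin (suc n)) ℓ) where

  -- A path between nonzero vertices leaves zero only towards a nonzero vertex (revisits of
  -- zero can be skipped), so such paths are exactly the paths of the relation bypass.
  bypass : Rel (Fin n) ℓ
  bypass i j = R (suc i) (suc j) ⊎ (R (suc i) zero × R zero (suc j))

  lift-bypass : ∀ {i j} → Star bypass i j → Star R (suc i) (suc j)
  lift-bypass ε                    = ε
  lift-bypass (inj₁ r ◅ rs)        = r ◅ lift-bypass rs
  lift-bypass (inj₂ (r , r′) ◅ rs) = r ◅ r′ ◅ lift-bypass rs

  BypassFrom : Fin (suc n) → Fin n → Set ℓ
  BypassFrom zero    j = ∃ λ k → R zero (suc k) × Star bypass k j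
  BypassFrom (suc i) j = Star bypass i j

  bypass-to-suc : ∀ {x j} → Star R x (suc j) → BypassFrom x j
  bypass-to-suc {suc i} ε = ε
  bypass-to-suc {zero}  (_◅_ {j = zero}  _ rs) = bypass-to-suc rs
  bypass-to-suc {zero}  (_◅_ {j = suc k} r rs) = k , r , bypass-to-suc rs
  bypass-to-suc {suc i} (_◅_ {j = suc k} r rs) = inj₁ r ◅ bypass-to-suc rs
  bypass-to-suc {suc i} (_◅_ {j = zero}  r rs) with bypass-to-suc rs
  ... | k , r′ , rs′ = inj₂ (r , r′) ◅ rs′

  bypass-to-zero : ∀ {i} → Star R (suc i) zero → ∃ λ k → Star bypass i k × R (suc k) zero
  bypass-to-zero {i} (_◅_ {j = zero}  r _)  = i , ε , r
  bypass-to-zero     (_◅_ {j = suc _} r rs) with bypass-to-zero rs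
  ... | k , rs′ , r′ = k , inj₁ r ◅ rs′ , r′

  bypass? : Decidable R → Decidable bypass
  bypass? R? i j = R? (suc i) (suc j) ⊎-dec (R? (suc i) zero ×-dec R? zero (suc j))

star? : ∀ {n} {R : Rel (Fin n) ℓ} → Decidable R → Decidable (Star R)
star? {n = suc n} {R} R? zero zero = yes ε
star? {n = suc n} {R} R? zero (suc j) =
  map′ (λ (k , r , rs) → r ◅ lift-bypass R rs) (bypass-to-suc R)
       (any? λ k → R? zero (suc k) ×-dec star? (bypass? R R?) k j)
star? {n = suc n} {R} R? (suc i) zero =
  map′ (λ (k , rs , r) → lift-bypass R rs ◅◅ r ◅ ε) (bypass-to-zero R)
       (any? λ k → star? (bypass? R R?) i k ×-dec R? (suc k) zero)
star? {n = suc n} {R} R? (suc i) (suc j) =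
  map′ (lift-bypass R) (bypass-to-suc R) (star? (bypass? R R?) i j)

record IsRainbowTransitive {a} {A : Set a} (part : A → Fin 3) (_⇒_ : Rel A ℓ) : Set (a ⊔ ℓ) where
  field
    crosses       : ∀ {x y} → x ⇒ y → part x ≢ part y
    total         : ∀ {x y} → part x ≢ part y → x ⇒ y ⊎ y ⇒ x
    asym          : ∀ {x y} → x ⇒ y → ¬ y ⇒ x
    rainbow-trans : ∀ {x y z} → part x ≢ part z → x ⇒ y → y ⇒ z → x ⇒ z

module _ {a} {A : Set a} {part : A → Fin 3} where

  flip-isRainbowTransitive : {_⇒_ : Rel A ℓ} → IsRainbowTransitive part _⇒_ →
    IsRainbowTransitive part (flip _⇒_)
  flip-isRainbowTransitive T = record
    { crosses       = ≢-sym ∘ crosses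
    ; total         = total ∘ ≢-sym
    ; asym          = asym
    ; rainbow-trans = λ x≁z y⇒x z⇒y → rainbow-trans (≢-sym x≁z) z⇒y y⇒x
    }
    where open IsRainbowTransitive T

  module _ {_⇒_ : Rel A ℓ} (T : IsRainbowTransitive part _⇒_) {q₀ q₁ q₂ q₃ : A}
    (q₀⇒q₁ : q₀ ⇒ q₁) (q₁⇒q₂ : q₁ ⇒ q₂) (q₂⇒q₃ : q₂ ⇒ q₃) (q₃⇒q₀ : q₃ ⇒ q₀)
    (q₂∼q₀ : part q₂ ≡ part q₀) (q₃∼q₁ : part q₃ ≡ part q₁) where

    open IsRainbowTransitive T

    private
      Dominates : A → Set ℓ
      Dominates d = d ⇒ q₀ × d ⇒ q₁

      Dominated : A → Set ℓ
      Dominated w = q₀ ⇒ w × q₁ ⇒ w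

      dominates-or-dominated : ∀ {w} → part w ≢ part q₀ → part w ≢ part q₁ → Dominates w ⊎ Dominated w
      dominates-or-dominated {w} w≁q₀ w≁q₁ with total w≁q₀
      ... | inj₁ w⇒q₀ = inj₁ (w⇒q₀ , rainbow-trans w≁q₁ w⇒q₀ q₀⇒q₁)
      ... | inj₂ q₀⇒w = inj₂ (q₀⇒w , q₁⇒w)
        where
        q₃⇒w : q₃ ⇒ w
        q₃⇒w = rainbow-trans (λ e → w≁q₁ (trans (sym e) q₃∼q₁)) q₃⇒q₀ q₀⇒w
        q₂⇒w : q₂ ⇒ w
        q₂⇒w = rainbow-trans (λ e → w≁q₀ (trans (sym e) q₂∼q₀)) q₂⇒q₃ q₃⇒w
        q₁⇒w : q₁ ⇒ w
        q₁⇒w = rainbow-trans (≢-sym w≁q₁) q₁⇒q₂ q₂⇒w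

      module _ {Z : Fin 3} (Z≢X : Z ≢ part q₀) (Z≢Y : Z ≢ part q₁) where

        Reached : A → Set (a ⊔ ℓ)
        Reached v = (part v ≡ Z → ¬ Dominates v)
                  × (part v ≢ Z → ∀ {d} → part d ≡ Z → Dominates d → d ⇒ v)

        reached-start : Reached q₀
        reached-start = (λ q₀∈Z _ → Z≢X (sym q₀∈Z)) , λ _ _ → proj₁

        reached-step : ∀ {v w} → Reached v → v ⇒ w → Reached w
        reached-step {v} {w} (v-low , v-high) v⇒w = w-low , w-high
          where
          w-low : part w ≡ Z → ¬ Dominates w
          w-low w∈Z w-dom with part v ≟F Z
          ... | yes v∈Z = crosses v⇒w (trans v∈Z (sym w∈Z))
          ... | no v∉Z  = asym v⇒w (v-high v∉Z w∈Z w-dom)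

          w-high : part w ≢ Z → ∀ {d} → part d ≡ Z → Dominates d → d ⇒ w
          w-high w∉Z {d} d∈Z d-dom@(d⇒q₀ , d⇒q₁) = d⇒w
            where
            d≁w : part d ≢ part w
            d≁w e = w∉Z (trans (sym e) d∈Z)

            d⇒w : d ⇒ w
            d⇒w with part v ≟F Z
            ... | no v∉Z = rainbow-trans d≁w (v-high v∉Z d∈Z d-dom) v⇒w
            ... | yes v∈Z with dominates-or-dominated (λ e → Z≢X (trans (sym v∈Z) e)) (λ e → Z≢Y (trans (sym v∈Z) e))
            ...   | inj₁ v-dom = contradiction v-dom (v-low v∈Z)
            ...   | inj₂ (q₀⇒v , q₁⇒v) with part w ≟F part q₀
            ...     | no w≁q₀  = rainbow-trans d≁w d⇒q₀ (rainbow-trans (≢-sym w≁q₀) q₀⇒v v⇒w)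
            ...     | yes w∼q₀ = rainbow-trans d≁w d⇒q₁
                                   (rainbow-trans (λ e → crosses q₀⇒q₁ (sym (trans e w∼q₀))) q₁⇒v v⇒w)

        reached : ∀ {u v} → Reached u → Star _⇒_ u v → Reached v
        reached r ε          = r
        reached r (u⇒ ◅ ⇝v) = reached (reached-step r u⇒) ⇝v

    square-dominates-reachable : ∀ {w} → part w ≢ part q₀ → part w ≢ part q₁ → Star _⇒_ q₀ w → q₀ ⇒ w
    square-dominates-reachable w≁q₀ w≁q₁ q₀⇝w with dominates-or-dominated w≁q₀ w≁q₁
    ... | inj₁ w-dom    = contradiction w-dom (proj₁ (reached w≁q₀ w≁q₁ (reached-start w≁q₀ w≁q₁) q₀⇝w) refl)
    ... | inj₂ (q₀⇒w , _) = q₀⇒w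

  square-isolates : {_⇒_ : Rel A ℓ} → IsRainbowTransitive part _⇒_ → ∀ {q₀ q₁ q₂ q₃ w} →
    q₀ ⇒ q₁ → q₁ ⇒ q₂ → q₂ ⇒ q₃ → q₃ ⇒ q₀ → part q₂ ≡ part q₀ → part q₃ ≡ part q₁ →
    part w ≢ part q₀ → part w ≢ part q₁ → Star _⇒_ q₀ w → ¬ Star _⇒_ w q₀
  square-isolates T q₀⇒q₁ q₁⇒q₂ q₂⇒q₃ q₃⇒q₀ q₂∼q₀ q₃∼q₁ w≁q₀ w≁q₁ q₀⇝w w⇝q₀ =
    IsRainbowTransitive.asym T
      (square-dominates-reachable T q₀⇒q₁ q₁⇒q₂ q₂⇒q₃ q₃⇒q₀ q₂∼q₀ q₃∼q₁ w≁q₀ w≁q₁ q₀⇝w)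
      (square-dominates-reachable (flip-isRainbowTransitive T) q₃⇒q₀ q₂⇒q₃ q₁⇒q₂ q₀⇒q₁
         q₂∼q₀ (sym q₃∼q₁) w≁q₀ (λ e → w≁q₁ (trans e q₃∼q₁)) (reverse id w⇝q₀))

module _ {n} (G : Graph n) (p : Part3 n) {W : VSet n} where

  curious-restrict : Curious G p All → Curious G p W
  curious-restrict (independent , rainbow) =
    (λ x y _ _ → independent x y tt tt) , λ x y z _ _ _ → rainbow x y z tt tt tt

  has2P2Avoiding? : Decidable₁ W → ∀ k → Dec (Has2P2Avoiding G p W k)
  has2P2Avoiding? W? k = any? λ x₁ → any? λ y₁ → any? λ x₂ → any? λ y₂ →
    (W? x₁ ×-dec W? y₁ ×-dec W? x₂ ×-dec W? y₂) ×-dec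
    (¬? (p x₁ ≟F k) ×-dec ¬? (p y₁ ≟F k) ×-dec ¬? (p x₂ ≟F k) ×-dec ¬? (p y₂ ≟F k)) ×-dec
    (E-dec G x₁ y₁ ×-dec E-dec G x₂ y₂) ×-dec
    (¬? (E-dec G x₁ x₂) ×-dec ¬? (E-dec G x₁ y₂) ×-dec ¬? (E-dec G y₁ x₂) ×-dec ¬? (E-dec G y₁ y₂))

  ofTypeAtMost-1 : (H? : ∀ k → Dec (Has2P2Avoiding G p W k)) →
    (∀ {k k′} → k ≢ k′ → Has2P2Avoiding G p W k → ¬ Has2P2Avoiding G p W k′) → OfTypeAtMost G p W 1
  ofTypeAtMost-1 H? unique = isYes ∘ H? , (λ k → toWitness , fromWitness) , count3-exclusive H? unique

module Orientation {n} (G : Graph n) (p : Part3 n) where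

  Homogeneous : Fin n → Fin n → Fin n → Set
  Homogeneous x y z = (E G x y × E G y z × E G x z) ⊎ (¬ E G x y × ¬ E G y z × ¬ E G x z)

  homogeneous-rotate : ∀ {x y z} → Homogeneous x y z → Homogeneous y z x
  homogeneous-rotate (inj₁ (xy , yz , xz)) = inj₁ (yz , E-sym G xz , E-sym G xy)
  homogeneous-rotate (inj₂ (xy , yz , xz)) = inj₂ (yz , xz ∘ E-sym G , xy ∘ E-sym G)

  infix 4 _⇒_
  _⇒_ : Rel (Fin n) _
  x ⇒ y = (p y ≡ next3 (p x) × E G x y) ⊎ (p x ≡ next3 (p y) × ¬ E G x y)

  _⇒?_ : Decidable _⇒_
  x ⇒? y = ((p y ≟F next3 (p x)) ×-dec E-dec G x y) ⊎-dec ((p x ≟F next3 (p y)) ×-dec ¬? (E-dec G x y))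

  ⇒-crosses : ∀ {x y} → x ⇒ y → p x ≢ p y
  ⇒-crosses {x} (inj₁ (y∼ , _)) x∼y = next3-irrefl (p x) (trans (sym y∼) (sym x∼y))
  ⇒-crosses {y = y} (inj₂ (x∼ , _)) x∼y = next3-irrefl (p y) (trans (sym x∼) x∼y)

  ⇒-total : ∀ {x y} → p x ≢ p y → x ⇒ y ⊎ y ⇒ x
  ⇒-total {x} {y} x≁y with ≢⇒adjacent x≁y | E-dec G x y
  ... | inj₁ y∼ | yes xy = inj₁ (inj₁ (y∼ , xy))
  ... | inj₁ y∼ | no ¬xy = inj₂ (inj₂ (y∼ , ¬xy ∘ E-sym G))
  ... | inj₂ x∼ | yes xy = inj₂ (inj₁ (x∼ , E-sym G xy))
  ... | inj₂ x∼ | no ¬xy = inj₁ (inj₂ (x∼ , ¬xy))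

  ⇒-asym : ∀ {x y} → x ⇒ y → ¬ y ⇒ x
  ⇒-asym {x} (inj₁ (y∼ , _))  (inj₁ (x∼ , _))  = next3²-irrefl (p x) (sym (trans x∼ (cong next3 y∼)))
  ⇒-asym     (inj₁ (_ , xy))  (inj₂ (_ , ¬yx)) = ¬yx (E-sym G xy)
  ⇒-asym     (inj₂ (_ , ¬xy)) (inj₁ (_ , yx))  = ¬xy (E-sym G yx)
  ⇒-asym {x} (inj₂ (x∼ , _))  (inj₂ (y∼ , _))  = next3²-irrefl (p x) (sym (trans x∼ (cong next3 y∼)))

  module _ (cur : Curious G p All) where

    cyclic-inhomogeneous : ∀ {x y z} → p y ≡ next3 (p x) → p z ≡ next3 (p y) →
      ¬ Homogeneous x y z
    cyclic-inhomogeneous {x} {y} {z} y∼ z∼ h with p x in x∼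
    ... | zero = proj₂ cur x y z tt tt tt x∼ y∼ (trans z∼ (cong next3 y∼)) h
    ... | suc zero =
      proj₂ cur z x y tt tt tt (trans z∼ (cong next3 y∼)) x∼ y∼ (homogeneous-rotate (homogeneous-rotate h))
    ... | suc (suc zero) =
      proj₂ cur y z x tt tt tt y∼ (trans z∼ (cong next3 y∼)) x∼ (homogeneous-rotate h)

    ⇒-acyclic₃ : ∀ {x y z} → x ⇒ y → y ⇒ z → ¬ z ⇒ x
    ⇒-acyclic₃ (inj₁ (y∼ , xy)) (inj₁ (z∼ , yz)) (inj₁ (_ , zx)) =
      cyclic-inhomogeneous y∼ z∼ (inj₁ (xy , yz , E-sym G zx))
    ⇒-acyclic₃ (inj₂ (x∼ , ¬xy)) (inj₂ (y∼ , ¬yz)) (inj₂ (_ , ¬zx)) =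
      cyclic-inhomogeneous y∼ x∼ (inj₂ (¬yz ∘ E-sym G , ¬xy ∘ E-sym G , ¬zx))
    ⇒-acyclic₃ (inj₁ (y∼ , _)) (inj₂ (y∼′ , _)) z⇒x = ⇒-crosses z⇒x (next3-injective (trans (sym y∼′) y∼))
    ⇒-acyclic₃ (inj₂ (x∼ , _)) (inj₁ (z∼ , _)) z⇒x = ⇒-crosses z⇒x (trans z∼ (sym x∼))
    ⇒-acyclic₃ x⇒y (inj₁ (z∼ , _)) (inj₂ (z∼′ , _)) = ⇒-crosses x⇒y (next3-injective (trans (sym z∼′) z∼))
    ⇒-acyclic₃ x⇒y (inj₂ (y∼ , _)) (inj₁ (x∼ , _)) = ⇒-crosses x⇒y (trans x∼ (sym y∼))

    ⇒-isRainbowTransitive : IsRainbowTransitive p _⇒_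
    ⇒-isRainbowTransitive = record
      { crosses       = ⇒-crosses
      ; total         = ⇒-total
      ; asym          = ⇒-asym
      ; rainbow-trans = λ x≁z x⇒y y⇒z → [ id , (λ z⇒x → contradiction z⇒x (⇒-acyclic₃ x⇒y y⇒z)) ]′ (⇒-total x≁z)
      }

module Slicing {n} (G : Graph n) (p : Part3 n) (cur : Curious G p All) where

  open Orientation G p

  Reach : Rel (Fin n) _
  Reach = Star _⇒_

  StronglyConnected : Rel (Fin n) _
  StronglyConnected x y = Reach x y × Reach y x

  edge-crosses : ∀ {x y} → E G x y → p x ≢ p y
  edge-crosses {x} {y} xy x∼y = proj₁ cur x y tt tt x∼y xy

  induced-2P2-isolates : ∀ {a₁ b₁ a₂ b₂ w} → p a₂ ≡ p a₁ → p b₂ ≡ p b₁ →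
    E G a₁ b₁ → E G a₂ b₂ → ¬ E G a₁ b₂ → ¬ E G a₂ b₁ →
    p w ≢ p a₁ → p w ≢ p b₁ → StronglyConnected a₁ w → ¬ StronglyConnected b₁ w
  induced-2P2-isolates a₂∼ b₂∼ a₁b₁ a₂b₂ ¬a₁b₂ ¬a₂b₁ w≁a₁ w≁b₁ (a₁⇝w , w⇝a₁) (b₁⇝w , w⇝b₁)
    with ≢⇒adjacent (edge-crosses a₁b₁)
  ... | inj₁ b₁∼ =
    square-isolates (⇒-isRainbowTransitive cur)
      (inj₁ (b₁∼ , a₁b₁))
      (inj₂ (trans b₁∼ (cong next3 (sym a₂∼)) , ¬a₂b₁ ∘ E-sym G))
      (inj₁ (trans b₂∼ (trans b₁∼ (cong next3 (sym a₂∼))) , a₂b₂))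
      (inj₂ (trans b₂∼ b₁∼ , ¬a₁b₂ ∘ E-sym G))
      a₂∼ b₂∼ w≁a₁ w≁b₁ a₁⇝w w⇝a₁
  ... | inj₂ a₁∼ =
    square-isolates (⇒-isRainbowTransitive cur)
      (inj₁ (a₁∼ , E-sym G a₁b₁))
      (inj₂ (trans a₁∼ (cong next3 (sym b₂∼)) , ¬a₁b₂))
      (inj₁ (trans a₂∼ (trans a₁∼ (cong next3 (sym b₂∼))) , E-sym G a₂b₂))
      (inj₂ (trans a₂∼ a₁∼ , ¬a₂b₁))
      b₂∼ a₂∼ w≁b₁ w≁a₁ b₁⇝w w⇝b₁

  ancestors : Fin n → Subset n
  ancestors v = toSubset (λ u → star? _⇒?_ u v)

  slice : Fin n → ℕ
  slice v = ∣ ancestors v ∣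

  ancestors-⊆ : ∀ {x y} → Reach x y → ancestors x ⊆ ancestors y
  ancestors-⊆ x⇝y u∈ = ∈-toSubset⁺ (∈-toSubset⁻ u∈ ◅◅ x⇝y)

  slice-mono : ∀ {x y} → Reach x y → slice x ≤ slice y
  slice-mono = p⊆q⇒∣p∣≤∣q∣ ∘ ancestors-⊆

  slice-strict : ∀ {x y} → Reach x y → ¬ Reach y x → slice x < slice y
  slice-strict {y = y} x⇝y ¬y⇝x = p⊂q⇒∣p∣<∣q∣ (ancestors-⊆ x⇝y , y , ∈-toSubset⁺ ε , ¬y⇝x ∘ ∈-toSubset⁻)

  slice-isSliceDecomposition : IsSliceDecomposition G p slice
  slice-isSliceDecomposition x y x<y = forward , backward
    where
    forward : p y ≡ next3 (p x) → E G x y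
    forward y∼ with E-dec G x y
    ... | yes xy = xy
    ... | no ¬xy = contradiction (slice-mono (inj₂ (y∼ , ¬xy ∘ E-sym G) ◅ ε)) (<⇒≱ x<y)

    backward : p y ≡ next3 (next3 (p x)) → ¬ E G x y
    backward y∼ xy = <⇒≱ x<y
      (slice-mono (inj₁ (trans (sym (next3-cube (p x))) (cong next3 (sym y∼)) , E-sym G xy) ◅ ε))

  same-slice-reach : ∀ {x y} → slice x ≡ slice y → p x ≢ p y → Reach x y
  same-slice-reach {x} {y} x≈y x≁y with star? _⇒?_ x y
  ... | yes x⇝y = x⇝y
  ... | no ¬x⇝y with ⇒-total x≁y
  ...   | inj₁ x⇒y = contradiction (x⇒y ◅ ε) ¬x⇝y
  ...   | inj₂ y⇒x = contradiction (slice-strict (y⇒x ◅ ε) ¬x⇝y) (<-irrefl (sym x≈y))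

  same-slice-connected : ∀ {x y} → slice x ≡ slice y → p x ≢ p y → StronglyConnected x y
  same-slice-connected x≈y x≁y = same-slice-reach x≈y x≁y , same-slice-reach (sym x≈y) (≢-sym x≁y)

  2P2-in-slice-avoids : ∀ {j k} → Has2P2Avoiding G p (Slice slice j) k →
    ∀ {w} → slice w ≡ j → p w ≢ k
  2P2-in-slice-avoids (x₁ , y₁ , x₂ , y₂ , (x₁∈j , y₁∈j , _ , _) , (x₁≁k , y₁≁k , x₂≁k , y₂≁k) ,
                       (x₁y₁ , x₂y₂) , (¬x₁x₂ , ¬x₁y₂ , ¬y₁x₂ , ¬y₁y₂)) {w} w∈j w∼k =
    [ (λ (x₂∼ , y₂∼) → isolates x₂∼ y₂∼ x₂y₂ ¬x₁y₂ (¬y₁x₂ ∘ E-sym G))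
    , (λ (y₂∼ , x₂∼) → isolates y₂∼ x₂∼ (E-sym G x₂y₂) ¬x₁x₂ (¬y₁y₂ ∘ E-sym G))
    ]′ (avoiding-pairs-match x₁≁k y₁≁k x₂≁k y₂≁k (edge-crosses x₁y₁) (edge-crosses x₂y₂))
    where
    w≁ : ∀ {v} → p v ≢ _ → p w ≢ p v
    w≁ v≁k e = v≁k (trans (sym e) w∼k)

    connected : ∀ {v} → slice v ≡ _ → p v ≢ _ → StronglyConnected v w
    connected v∈j v≁k = same-slice-connected (trans v∈j (sym w∈j)) (≢-sym (w≁ v≁k))

    isolates : ∀ {a₂ b₂} → p a₂ ≡ p x₁ → p b₂ ≡ p y₁ → E G a₂ b₂ → ¬ E G x₁ b₂ → ¬ E G a₂ y₁ → ⊥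
    isolates a₂∼ b₂∼ a₂b₂ ¬x₁b₂ ¬a₂y₁ =
      induced-2P2-isolates a₂∼ b₂∼ x₁y₁ a₂b₂ ¬x₁b₂ ¬a₂y₁ (w≁ x₁≁k) (w≁ y₁≁k)
        (connected x₁∈j x₁≁k) (connected y₁∈j y₁≁k)

  2P2-in-slice-unique : ∀ {j k k′} → k ≢ k′ → Has2P2Avoiding G p (Slice slice j) k →
    ¬ Has2P2Avoiding G p (Slice slice j) k′
  2P2-in-slice-unique k≢k′ h (x₁ , y₁ , _ , _ , (x₁∈j , y₁∈j , _) , (x₁≁k′ , y₁≁k′ , _) , (x₁y₁ , _) , _)
    with avoiding-collide x₁≁k′ y₁≁k′ k≢k′
  ... | inj₁ x₁∼y₁        = edge-crosses x₁y₁ x₁∼y₁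
  ... | inj₂ (inj₁ x₁∼k) = 2P2-in-slice-avoids h x₁∈j x₁∼k
  ... | inj₂ (inj₂ y₁∼k) = 2P2-in-slice-avoids h y₁∈j y₁∼k

  slice-ofTypeAtMost-1 : ∀ j → OfTypeAtMost G p (Slice slice j) 1
  slice-ofTypeAtMost-1 j = ofTypeAtMost-1 G p (has2P2Avoiding? G p (λ v → slice v ≟ℕ j)) 2P2-in-slice-unique

curious-slices : ∀ {n} (G : Graph n) (p : Part3 n) → Curious G p All →
  ∃[ sl ] (IsSliceDecomposition G p sl × (∀ j → Curious G p (Slice sl j) × OfTypeAtMost G p (Slice sl j) 1))
curious-slices G p cur =
  slice , slice-isSliceDecomposition , λ j → curious-restrict G p cur , slice-ofTypeAtMost-1 j
  where open Slicing G p cur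

lemma13 : (t : ℕ) → (t ≡ 2 ⊎ t ≡ 3) →
    {n : ℕ} (G : Graph n) (p : Part3 n) →
    Curious G p All → OfType G p All t →
    ∃[ σ ] ∃[ sl ] (IsSliceDecomposition G (rename σ p) sl ×
      (∀ j → Curious G (rename σ p) (Slice sl j) × OfTypeAtMost G (rename σ p) (Slice sl j) (t ∸ 1)))
lemma13 t t∈23 G p cur _ with curious-slices G p cur
... | sl , decomposition , slices = Perm.id , sl , decomposition , λ j → weaken (slices j)
  where
  1≤t∸1 : 1 ≤ t ∸ 1
  1≤t∸1 = [ (λ { refl → s≤s z≤n }) , (λ { refl → s≤s z≤n }) ]′ t∈23

  weaken : ∀ {W} → Curious G p W × OfTypeAtMost G p W 1 → Curious G p W × OfTypeAtMost G p W (t ∸ 1)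
  weaken (curious , b , records , count≤1) = curious , b , records , ≤-trans count≤1 1≤t∸1
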